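{- For all integers $t\ge4$ and $r\ge3$, $C_r(n,M_t)=\Omega\left(n^{\frac{1}{2r+1}}\right)$ as $n\to\infty$, where $M_t$ is the $r$-graph consisting of $t$ pairwise disjoint edges.
   Context: An $r$-graph is an $r$-uniform hypergraph; $K_n^{(r)}$ is the complete $r$-graph on $n$ vertices. For an $r$-graph $H$, an $(n,r,H)$-local coloring with $k$ colors is a family of $n$ edge-colorings $f_v:E(K_n^{(r)})\to[k]$, one for each vertex $v$ of $K_n^{(r)}$, such that for every copy $T$ of $H$ in $K_n^{(r)}$ there is a vertex $u\in V(T)$ for which $f_u$ is rainbow on $T$ (no two edges of $T$ get the same color under $f_u$). $C_r(n,H)$ is the minimum such $k$. -}

module Defs where

open import Data.Nat using (ℕ)
open import Data.Fin using (Fin)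
open import Data.Fin.Subset using (Subset; _∈_; ∣_∣)
open import Data.Product using (Σ; _×_; ∃)
open import Data.Empty using (⊥)
open import Relation.Binary.PropositionalEquality using (_≡_; _≢_)

IsEdge : (n r : ℕ) → Subset n → Set
IsEdge n r e = ∣ e ∣ ≡ r

Disjoint : {n : ℕ} → Subset n → Subset n → Set
Disjoint {n} e e' = (x : Fin n) → x ∈ e → x ∈ e' → ⊥

IsCopyOfMatching : (n r t : ℕ) → (Fin t → Subset n) → Set
IsCopyOfMatching n r t T =
  ((i : Fin t) → IsEdge n r (T i)) × ((i j : Fin t) → i ≢ j → Disjoint (T i) (T j))

InCopy : {n t : ℕ} → Fin n → (Fin t → Subset n) → Set
InCopy {t = t} u T = Σ (Fin t) λ i → u ∈ T i

Rainbow : {n t k : ℕ} → (Subset n → Fin k) → (Fin t → Subset n) → Set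
Rainbow {t = t} c T = (i j : Fin t) → i ≢ j → c (T i) ≢ c (T j)

-- An (n, r, M_t)-local colouring with k colours: one edge-colouring f v per
-- vertex v (values on non-edges are irrelevant), such that every copy of M_t
-- has a vertex u with f u rainbow on it.
LocalColoring : (n r t k : ℕ) → (Fin n → Subset n → Fin k) → Set
LocalColoring n r t k f =
  (T : Fin t → Subset n) → IsCopyOfMatching n r t T →
  Σ (Fin n) λ u → InCopy u T × Rainbow (f u) T

HasLocalColoring : (n r t k : ℕ) → Set
HasLocalColoring n r t k = Σ (Fin n → Subset n → Fin k) λ f → LocalColoring n r t k f

{-# OPTIONS --safe #-}
module Submission where

-- Set aside m = 2k disjoint blocks of r vertices. Each of the N other (outer) vertices colours
-- the m blocks with k colours, so it gives at least k ordered pairs of distinct blocks the same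
-- colour. Double counting over the m² pairs yields blocks B ≠ B′ and L = (k^{2r} + 1 + t′) r
-- outer vertices each colouring B and B′ alike, as soon as N k > m² L, which holds once
-- n > r (10 + 4t′) k^{2r+1}. Split those L vertices into edges. The 2r vertices of B ∪ B′ give
-- each edge a colour vector, so two of the first k^{2r} + 1 edges, C and C′, get the same vector.
-- Then B, B′, C, C′ and the last t′ edges form a copy of M_{t′+4} with no rainbow vertex: a
-- vertex of B ∪ B′ colours C and C′ alike, and any other vertex of the copy colours B and B′
-- alike.

open import Data.Bool using (if_then_else_)
open import Data.Fin using (Fin; zero; suc; combine; _↑ˡ_; _↑ʳ_; splitAt; funToFin; finToFun)
open import Data.Fin.Properties
  using (any?; combine-injective; ↑ˡ-injective; ↑ʳ-injective; splitAt-↑ˡ; splitAt-↑ʳ;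
         finToFun-funToFin; pigeonhole)
  renaming (_≟_ to _≟ᶠ_; suc-injective to sucᶠ-injective; <⇒≢ to <⇒≢ᶠ)
open import Data.Fin.Subset using (Subset; _∈_; _∉_; ∣_∣; ⁅_⁆; _∪_; inside; outside)
  renaming (⊥ to ∅)
open import Data.Fin.Subset.Properties
  using (_∈?_; ∉⊥; x∈⁅y⁆⇒x≡y; x∈p∪q⁻; ∣⊥∣≡0; ∣p∣≤n; ∪-identityˡ)
open import Data.Nat
  using (ℕ; zero; suc; _+_; _*_; _∸_; _^_; _≤_; _<_; z≤n; s≤s; _<?_; _≤?_; NonZero)
open import Data.Nat.Properties
open import Algebra.Properties.CommutativeMonoid.Sum +-0-commutativeMonoid
  using (sum; sum-syntax; ∑-comm; sum-cong-≗)
open import Data.Nat.Tactic.RingSolver using (solve-∀)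
open import Level using (_⊔_)
open import Data.Product using (Σ; ∃; ∃₂; _×_; _,_; proj₁; proj₂)
open import Data.Sum using (inj₁; inj₂; [_,_]′)
open import Data.Vec using (_∷_; here; there)
open import Defs
open import Function using (_∘_)
open import Function.Definitions using (Injective)
open import Relation.Binary.PropositionalEquality
open import Relation.Nullary using (Dec; yes; no; does; ¬_; contradiction)
open import Relation.Nullary.Decidable using (_×-dec_; ¬?)
open import Relation.Unary using (Pred; Decidable)

indicator : ∀ {p} {P : Set p} → Dec P → ℕ
indicator d = if does d then 1 else 0

1≤indicator : ∀ {p} {P : Set p} (d : Dec P) → P → 1 ≤ indicator d
1≤indicator (yes _) _ = s≤s z≤n
1≤indicator (no ¬p) p = contradiction p ¬p

∑-mono-≤ : ∀ {n} {f g : Fin n → ℕ} → (∀ i → f i ≤ g i) → sum f ≤ sum g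
∑-mono-≤ {zero} _ = z≤n
∑-mono-≤ {suc n} f≤g = +-mono-≤ (f≤g zero) (∑-mono-≤ (f≤g ∘ suc))

∑-const : ∀ n b → ∑[ i < n ] b ≡ n * b
∑-const zero b = refl
∑-const (suc n) b = cong (b +_) (∑-const n b)

term≤∑ : ∀ {n} (f : Fin n → ℕ) i → f i ≤ sum f
term≤∑ f zero = m≤m+n _ _
term≤∑ f (suc i) = ≤-trans (term≤∑ (f ∘ suc) i) (m≤n+m _ _)

∑>*⇒∃> : ∀ {n} (f : Fin n → ℕ) b → n * b < sum f → ∃ λ i → b < f i
∑>*⇒∃> {n} f b n*b<∑ with any? (λ i → b <? f i)
... | yes found = found
... | no none = contradiction n*b<∑ (≤⇒≯ (begin
    sum f         ≤⟨ ∑-mono-≤ (λ i → ≮⇒≥ (none ∘ (i ,_))) ⟩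
    ∑[ i < n ] b  ≡⟨ ∑-const n b ⟩
    n * b         ∎))
  where open ≤-Reasoning

count : ∀ {n p} {P : Pred (Fin n) p} → Decidable P → ℕ
count {n} P? = ∑[ i < n ] indicator (P? i)

∃⇒1≤count : ∀ {n p} {P : Pred (Fin n) p} (P? : Decidable P) → ∃ P → 1 ≤ count P?
∃⇒1≤count P? (i , Pi) = ≤-trans (1≤indicator (P? i) Pi) (term≤∑ (λ j → indicator (P? j)) i)

enumerate : ∀ {n L p} {P : Pred (Fin n) p} (P? : Decidable P) → L ≤ count P? →
  Σ (Fin L → Fin n) λ e → Injective _≡_ _≡_ e × (∀ j → P (e j))
enumerate {L = zero} P? _ = (λ ()) , (λ { {()} }) , (λ ())
enumerate {zero} {suc L} P? ()
enumerate {suc n} {suc L} P? L≤count with P? zero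
... | yes P0 with e , e-injective , Pe ← enumerate (P? ∘ suc) (≤-pred L≤count) =
  e₀ , e₀-injective , λ { zero → P0 ; (suc j) → Pe j }
  where
  e₀ : Fin (suc L) → Fin (suc n)
  e₀ zero = zero
  e₀ (suc j) = suc (e j)
  e₀-injective : Injective _≡_ _≡_ e₀
  e₀-injective {zero} {zero} _ = refl
  e₀-injective {suc i} {suc j} eq = cong suc (e-injective (sucᶠ-injective eq))
... | no _ with e , e-injective , Pe ← enumerate (P? ∘ suc) L≤count =
  suc ∘ e , e-injective ∘ sucᶠ-injective , Pe

∣⁅x⁆∪p∣≡∣p∣ : ∀ {n} {x : Fin n} {p : Subset n} → x ∈ p → ∣ ⁅ x ⁆ ∪ p ∣ ≡ ∣ p ∣
∣⁅x⁆∪p∣≡∣p∣ {p = _ ∷ p} here = cong (suc ∘ ∣_∣) (∪-identityˡ p)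
∣⁅x⁆∪p∣≡∣p∣ {p = inside ∷ _} (there x∈p) = cong suc (∣⁅x⁆∪p∣≡∣p∣ x∈p)
∣⁅x⁆∪p∣≡∣p∣ {p = outside ∷ _} (there x∈p) = ∣⁅x⁆∪p∣≡∣p∣ x∈p

∣⁅x⁆∪p∣≡1+∣p∣ : ∀ {n} {x : Fin n} {p : Subset n} → x ∉ p → ∣ ⁅ x ⁆ ∪ p ∣ ≡ suc ∣ p ∣
∣⁅x⁆∪p∣≡1+∣p∣ {x = zero} {inside ∷ _} x∉p = contradiction here x∉p
∣⁅x⁆∪p∣≡1+∣p∣ {x = zero} {outside ∷ p} _ = cong (suc ∘ ∣_∣) (∪-identityˡ p)
∣⁅x⁆∪p∣≡1+∣p∣ {x = suc _} {inside ∷ _} x∉p = cong suc (∣⁅x⁆∪p∣≡1+∣p∣ (x∉p ∘ there))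
∣⁅x⁆∪p∣≡1+∣p∣ {x = suc _} {outside ∷ _} x∉p = ∣⁅x⁆∪p∣≡1+∣p∣ (x∉p ∘ there)

image : ∀ {m n} → (Fin m → Fin n) → Subset n
image {zero} g = ∅
image {suc m} g = ⁅ g zero ⁆ ∪ image (g ∘ suc)

image⁻ : ∀ {m n} (g : Fin m → Fin n) {x} → x ∈ image g → ∃ λ a → g a ≡ x
image⁻ {zero} g x∈∅ = contradiction x∈∅ ∉⊥
image⁻ {suc m} g x∈ with x∈p∪q⁻ ⁅ g zero ⁆ (image (g ∘ suc)) x∈
... | inj₁ x∈⁅g₀⁆ = zero , sym (x∈⁅y⁆⇒x≡y (g zero) x∈⁅g₀⁆)
... | inj₂ x∈rest with a , ga≡x ← image⁻ (g ∘ suc) x∈rest = suc a , ga≡x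

repeats : ∀ {m n} → (Fin m → Fin n) → ℕ
repeats {zero} g = 0
repeats {suc m} g = indicator (g zero ∈? image (g ∘ suc)) + repeats (g ∘ suc)

repeats+∣image∣≡m : ∀ {m n} (g : Fin m → Fin n) → repeats g + ∣ image g ∣ ≡ m
repeats+∣image∣≡m {zero} {n} g = ∣⊥∣≡0 n
repeats+∣image∣≡m {suc m} g with g zero ∈? image (g ∘ suc)
... | yes g₀∈ rewrite ∣⁅x⁆∪p∣≡∣p∣ g₀∈ = cong suc (repeats+∣image∣≡m (g ∘ suc))
... | no g₀∉ rewrite ∣⁅x⁆∪p∣≡1+∣p∣ g₀∉ | +-suc (repeats (g ∘ suc)) ∣ image (g ∘ suc) ∣ =
  cong suc (repeats+∣image∣≡m (g ∘ suc))

repeats≡0 : ∀ {m n} {g : Fin m → Fin n} → Injective _≡_ _≡_ g → repeats g ≡ 0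
repeats≡0 {zero} _ = refl
repeats≡0 {suc m} {g = g} g-injective with g zero ∈? image (g ∘ suc)
... | yes g₀∈ with () ← g-injective (proj₂ (image⁻ (g ∘ suc) g₀∈))
... | no _ = repeats≡0 (sucᶠ-injective ∘ g-injective)

∣image∣≡m : ∀ {m n} {g : Fin m → Fin n} → Injective _≡_ _≡_ g → ∣ image g ∣ ≡ m
∣image∣≡m {g = g} g-injective =
  trans (cong (_+ ∣ image g ∣) (sym (repeats≡0 g-injective))) (repeats+∣image∣≡m g)

m≤repeats+n : ∀ {m n} (g : Fin m → Fin n) → m ≤ repeats g + n
m≤repeats+n g =
  subst (_≤ repeats g + _) (repeats+∣image∣≡m g) (+-monoʳ-≤ (repeats g) (∣p∣≤n (image g)))

Collision : ∀ {m k} → (Fin m → Fin k) → Fin m → Fin m → Set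
Collision v p q = p ≢ q × v p ≡ v q

collision? : ∀ {m k} (v : Fin m → Fin k) p q → Dec (Collision v p q)
collision? v p q = ¬? (p ≟ᶠ q) ×-dec (v p ≟ᶠ v q)

collisions : ∀ {m k} → (Fin m → Fin k) → ℕ
collisions {m} v = ∑[ q < m ] count (λ p → collision? v p q)

repeats≤collisions : ∀ {m k} (v : Fin m → Fin k) → repeats v ≤ collisions v
repeats≤collisions {zero} v = z≤n
repeats≤collisions {suc m} v = +-mono-≤ collisions-at-zero collisions-elsewhere
  where
  collisions-at-zero : indicator (v zero ∈? image (v ∘ suc)) ≤ count (λ p → collision? v p zero)
  collisions-at-zero with v zero ∈? image (v ∘ suc)
  ... | no _ = z≤n
  ... | yes v₀∈ with a , eq ← image⁻ (v ∘ suc) v₀∈ =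
    ∃⇒1≤count (λ p → collision? v p zero) (suc a , (λ ()) , eq)
  collisions-elsewhere : repeats (v ∘ suc) ≤ ∑[ q < m ] count (λ p → collision? v p (suc q))
  collisions-elsewhere = ≤-trans (repeats≤collisions (v ∘ suc)) (∑-mono-≤ λ q →
    m≤n+m (count (λ p → collision? (v ∘ suc) p q)) (indicator (collision? v zero (suc q))))

k≤collisions : ∀ {k} (v : Fin (k + k) → Fin k) → k ≤ collisions v
k≤collisions {k} v =
  +-cancelʳ-≤ k k (collisions v) (≤-trans (m≤repeats+n v) (+-monoˡ-≤ k (repeats≤collisions v)))

Injective₂ : ∀ {a b c} {A : Set a} {B : Set b} {C : Set c} → (A → B → C) → Set (a ⊔ b ⊔ c)
Injective₂ f = ∀ {x₁ x₂ y₁ y₂} → f x₁ y₁ ≡ f x₂ y₂ → x₁ ≡ x₂ × y₁ ≡ y₂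

image-isMatching : ∀ {n r t} (θ : Fin t → Fin r → Fin n) → Injective₂ θ →
  IsCopyOfMatching n r t (image ∘ θ)
image-isMatching θ θ-injective = (λ i → ∣image∣≡m (proj₂ ∘ θ-injective)) , disjoint
  where
  disjoint : ∀ i j → i ≢ j → Disjoint (image (θ i)) (image (θ j))
  disjoint i j i≢j x x∈θi x∈θj
    with a , refl ← image⁻ (θ i) x∈θi
    with b , θjb≡θia ← image⁻ (θ j) x∈θj
    = i≢j (proj₁ (θ-injective (sym θjb≡θia)))

↑ˡ≢↑ʳ : ∀ {a b} (i : Fin a) (j : Fin b) → i ↑ˡ b ≢ a ↑ʳ j
↑ˡ≢↑ʳ {a} {b} i j eq
  with () ← trans (sym (splitAt-↑ˡ a i b)) (trans (cong (splitAt a) eq) (splitAt-↑ʳ a b j))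

pigeonhole-≗ : ∀ {d k} (c : Fin (suc (k ^ d)) → Fin d → Fin k) → ∃₂ λ i j → i ≢ j × c i ≗ c j
pigeonhole-≗ {d} {k} c with i , j , i<j , cᵢ≡cⱼ ← pigeonhole (n<1+n (k ^ d)) (funToFin ∘ c) =
  i , j , <⇒≢ᶠ i<j , λ x → begin
    c i x                        ≡⟨ finToFun-funToFin (c i) x ⟨
    finToFun (funToFin (c i)) x  ≡⟨ cong (λ y → finToFun y x) cᵢ≡cⱼ ⟩
    finToFun (funToFin (c j)) x  ≡⟨ finToFun-funToFin (c j) x ⟩
    c j x                        ∎
  where open ≡-Reasoning

module Obstruction {r t' k N : ℕ}
                   (f : Fin ((k + k) * r + N) → Subset ((k + k) * r + N) → Fin k) where

  m K M L n : ℕ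
  m = k + k
  K = k ^ (r + r)
  M = suc K + t'
  L = M * r
  n = m * r + N

  blockVertex : Fin m → Fin r → Fin n
  blockVertex p a = combine p a ↑ˡ N

  block : Fin m → Subset n
  block p = image (blockVertex p)

  outerVertex : Fin N → Fin n
  outerVertex i = m * r ↑ʳ i

  blockColours : Fin N → Fin m → Fin k
  blockColours i p = f (outerVertex i) (block p)

  blockVertex-injective : Injective₂ blockVertex
  blockVertex-injective {p₁} {p₂} {a₁} {a₂} eq =
    combine-injective p₁ a₁ p₂ a₂ (↑ˡ-injective N _ _ eq)

  blockVertex≢outerVertex : ∀ {p a i} → blockVertex p a ≢ outerVertex i
  blockVertex≢outerVertex {p} {a} {i} = ↑ˡ≢↑ʳ (combine p a) i

  N*k≤collidingPairs : N * k ≤ ∑[ q < m ] ∑[ p < m ] count (λ i → collision? (blockColours i) p q)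
  N*k≤collidingPairs = begin
    N * k
      ≡⟨ ∑-const N k ⟨
    ∑[ i < N ] k
      ≤⟨ ∑-mono-≤ (k≤collisions ∘ blockColours) ⟩
    ∑[ i < N ] collisions (blockColours i)
      ≡⟨ ∑-comm (λ i q → count (λ p → collision? (blockColours i) p q)) ⟩
    ∑[ q < m ] ∑[ i < N ] count (λ p → collision? (blockColours i) p q)
      ≡⟨ sum-cong-≗ (λ q → ∑-comm (λ i p → indicator (collision? (blockColours i) p q))) ⟩
    ∑[ q < m ] ∑[ p < m ] count (λ i → collision? (blockColours i) p q) ∎
    where open ≤-Reasoning

  colliding-outer-vertices : m * (m * L) < N * k →
    ∃₂ λ p q → Σ (Fin L → Fin N) λ z →
      Injective _≡_ _≡_ z × (∀ j → Collision (blockColours (z j)) p q)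
  colliding-outer-vertices big
    with q , mL<∑ ← ∑>*⇒∃> _ (m * L) (<-≤-trans big N*k≤collidingPairs)
    with p , L<count ← ∑>*⇒∃> _ L mL<∑
    = p , q , enumerate (λ i → collision? (blockColours i) p q) (<⇒≤ L<count)

  module Placement {p q : Fin m} {z : Fin L → Fin N} (z-injective : Injective _≡_ _≡_ z)
                   (z-collides : ∀ j → Collision (blockColours (z j)) p q) where

    zVertex : Fin M → Fin r → Fin n
    zVertex j a = outerVertex (z (combine j a))

    zEdge : Fin M → Subset n
    zEdge j = image (zVertex j)

    pairVertex : Fin (r + r) → Fin n
    pairVertex x = [ blockVertex p , blockVertex q ]′ (splitAt r x)

    pairVertex-↑ˡ : ∀ a → pairVertex (a ↑ˡ r) ≡ blockVertex p a
    pairVertex-↑ˡ a = cong [ blockVertex p , blockVertex q ]′ (splitAt-↑ˡ r a r)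

    pairVertex-↑ʳ : ∀ a → pairVertex (r ↑ʳ a) ≡ blockVertex q a
    pairVertex-↑ʳ a = cong [ blockVertex p , blockVertex q ]′ (splitAt-↑ʳ r r a)

    zVertex-injective : Injective₂ zVertex
    zVertex-injective {j₁} {j₂} {a₁} {a₂} eq =
      combine-injective j₁ a₁ j₂ a₂ (z-injective (↑ʳ-injective (m * r) _ _ eq))

    -- Each z j collides at p and q, so p ≢ q; the argument a : Fin r only makes L nonzero.
    p≢q : Fin r → p ≢ q
    p≢q a = proj₁ (z-collides (combine {M} zero a))

    edgeColours : Fin (suc K) → Fin (r + r) → Fin k
    edgeColours j x = f (pairVertex x) (zEdge (j ↑ˡ t'))

    module Copy {J₁ J₂ : Fin (suc K)} (J₁≢J₂ : J₁ ≢ J₂)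
                (twins : edgeColours J₁ ≗ edgeColours J₂) where

      σ : Fin (2 + t') → Fin M
      σ zero = J₁ ↑ˡ t'
      σ (suc zero) = J₂ ↑ˡ t'
      σ (suc (suc i)) = suc K ↑ʳ i

      σ-injective : Injective _≡_ _≡_ σ
      σ-injective {zero} {zero} _ = refl
      σ-injective {zero} {suc zero} eq = contradiction (↑ˡ-injective t' J₁ J₂ eq) J₁≢J₂
      σ-injective {zero} {suc (suc j)} eq = contradiction eq (↑ˡ≢↑ʳ J₁ j)
      σ-injective {suc zero} {zero} eq = contradiction (↑ˡ-injective t' J₂ J₁ eq) (J₁≢J₂ ∘ sym)
      σ-injective {suc zero} {suc zero} _ = refl
      σ-injective {suc zero} {suc (suc j)} eq = contradiction eq (↑ˡ≢↑ʳ J₂ j)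
      σ-injective {suc (suc i)} {zero} eq = contradiction (sym eq) (↑ˡ≢↑ʳ J₁ i)
      σ-injective {suc (suc i)} {suc zero} eq = contradiction (sym eq) (↑ˡ≢↑ʳ J₂ i)
      σ-injective {suc (suc i)} {suc (suc j)} eq with refl ← ↑ʳ-injective (suc K) i j eq = refl

      θ : Fin (4 + t') → Fin r → Fin n
      θ zero = blockVertex p
      θ (suc zero) = blockVertex q
      θ (suc (suc i)) = zVertex (σ i)

      θ-injective : Injective₂ θ
      θ-injective {zero} {zero} eq = refl , proj₂ (blockVertex-injective eq)
      θ-injective {zero} {suc zero} {a} eq = contradiction (proj₁ (blockVertex-injective eq)) (p≢q a)
      θ-injective {zero} {suc (suc _)} eq = contradiction eq blockVertex≢outerVertex
      θ-injective {suc zero} {zero} {a} eq =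
        contradiction (sym (proj₁ (blockVertex-injective eq))) (p≢q a)
      θ-injective {suc zero} {suc zero} eq = refl , proj₂ (blockVertex-injective eq)
      θ-injective {suc zero} {suc (suc _)} eq = contradiction eq blockVertex≢outerVertex
      θ-injective {suc (suc _)} {zero} eq = contradiction (sym eq) blockVertex≢outerVertex
      θ-injective {suc (suc _)} {suc zero} eq = contradiction (sym eq) blockVertex≢outerVertex
      θ-injective {suc (suc i)} {suc (suc j)} eq
        with σi≡σj , a₁≡a₂ ← zVertex-injective eq
        with refl ← σ-injective {i} {j} σi≡σj
        = refl , a₁≡a₂

      copy : Fin (4 + t') → Subset n
      copy = image ∘ θ

      pairVertex-not-rainbow : ∀ x → ¬ Rainbow (f (pairVertex x)) copy
      pairVertex-not-rainbow x rainbow =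
        rainbow (suc (suc zero)) (suc (suc (suc zero))) (λ ()) (twins x)

      θ-not-rainbow : ∀ i a → ¬ Rainbow (f (θ i a)) copy
      θ-not-rainbow zero a =
        subst (λ v → ¬ Rainbow (f v) copy) (pairVertex-↑ˡ a) (pairVertex-not-rainbow (a ↑ˡ r))
      θ-not-rainbow (suc zero) a =
        subst (λ v → ¬ Rainbow (f v) copy) (pairVertex-↑ʳ a) (pairVertex-not-rainbow (r ↑ʳ a))
      θ-not-rainbow (suc (suc i)) a rainbow =
        rainbow zero (suc zero) (λ ()) (proj₂ (z-collides (combine (σ i) a)))

      not-local : ¬ LocalColoring n r (4 + t') k f
      not-local local
        with u , (i , u∈copy) , rainbow ← local copy (image-isMatching θ θ-injective)
        with a , refl ← image⁻ (θ i) u∈copy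
        = θ-not-rainbow i a rainbow

  no-local-colouring : m * (m * L) < N * k → ¬ LocalColoring n r (4 + t') k f
  no-local-colouring big
    with p , q , z , z-injective , z-collides ← colliding-outer-vertices big
    with J₁ , J₂ , J₁≢J₂ , twins ← pigeonhole-≗ (Placement.edgeColours z-injective z-collides)
    = Placement.Copy.not-local z-injective z-collides J₁≢J₂ twins

room-above-threshold : ∀ r t' k n .{{_ : NonZero k}} → r * (10 + 4 * t') * k ^ (2 * r + 1) < n →
  (k + k) * r + (k + k) * (2 * ((suc (k ^ (r + r)) + t') * r)) < n
room-above-threshold r t' k n DE<n = ≤-<-trans (begin
  (k + k) * r + (k + k) * (2 * ((suc K + t') * r))
    ≡⟨ expand k r t' K ⟩
  r * (6 + 4 * t') * k + 4 * r * (k * K)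
    ≤⟨ +-mono-≤ (*-monoʳ-≤ (r * (6 + 4 * t')) k≤E) (≤-reflexive (cong (4 * r *_) (sym E≡k*K))) ⟩
  r * (6 + 4 * t') * E + 4 * r * E
    ≡⟨ collect r t' E ⟩
  r * (10 + 4 * t') * E ∎) DE<n
  where
  open ≤-Reasoning
  K E : ℕ
  K = k ^ (r + r)
  E = k ^ (2 * r + 1)

  expand : ∀ k r t' K → (k + k) * r + (k + k) * (2 * ((suc K + t') * r)) ≡
                        r * (6 + 4 * t') * k + 4 * r * (k * K)
  expand = solve-∀
  collect : ∀ r t' E → r * (6 + 4 * t') * E + 4 * r * E ≡ r * (10 + 4 * t') * E
  collect = solve-∀
  2r+1≡1+[r+r] : ∀ r → 2 * r + 1 ≡ suc (r + r)
  2r+1≡1+[r+r] = solve-∀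

  E≡k*K : E ≡ k * K
  E≡k*K = cong (k ^_) (2r+1≡1+[r+r] r)

  k≤E : k ≤ E
  k≤E = subst (k ≤_) (sym E≡k*K) (m≤m*n k K {{m^n≢0 k (r + r)}})

uncolourable-above-threshold : ∀ r t' n k .{{_ : NonZero k}} →
  r * (10 + 4 * t') * k ^ (2 * r + 1) < n → ¬ HasLocalColoring n r (4 + t') k
uncolourable-above-threshold r t' n k DE<n coloured =
  Obstruction.no-local-colouring {r} {t'} {k} {n ∸ A} (proj₁ split) m*mL<[n∸A]*k (proj₂ split)
  where
  m L A Q : ℕ
  m = k + k
  L = (suc (k ^ (r + r)) + t') * r
  A = m * r
  -- Q outer vertices suffice for the double counting.
  Q = m * (2 * L)

  m*mL≡Q*k : ∀ k L → (k + k) * ((k + k) * L) ≡ (k + k) * (2 * L) * k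
  m*mL≡Q*k = solve-∀

  A+Q<n : A + Q < n
  A+Q<n = room-above-threshold r t' k n DE<n

  m*mL<[n∸A]*k : m * (m * L) < (n ∸ A) * k
  m*mL<[n∸A]*k = subst (_< (n ∸ A) * k) (sym (m*mL≡Q*k k L))
    (*-monoˡ-< k (m+n≤o⇒m≤o∸n (suc Q) (subst (λ x → suc x ≤ n) (+-comm A Q) A+Q<n)))

  split : HasLocalColoring (A + (n ∸ A)) r (4 + t') k
  split = subst (λ n → HasLocalColoring n r (4 + t') k)
                (sym (m+[n∸m]≡n (≤-trans (m≤m+n A Q) (<⇒≤ A+Q<n)))) coloured

local-colouring-bound : ∀ r t' n k → 1 ≤ n → HasLocalColoring n r (4 + t') k →
  n ≤ r * (10 + 4 * t') * k ^ (2 * r + 1)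
local-colouring-bound r t' (suc n) zero _ (f , _) with () ← f zero ∅
local-colouring-bound r t' n k@(suc _) _ coloured with n ≤? r * (10 + 4 * t') * k ^ (2 * r + 1)
... | yes bounded = bounded
... | no unbounded = contradiction coloured (uncolourable-above-threshold r t' n k (≰⇒> unbounded))

corollary1p8 : (t r : ℕ) → 4 ≤ t → 3 ≤ r →
    Σ ℕ λ D → Σ ℕ λ N → (n : ℕ) → N ≤ n →
      (k : ℕ) → HasLocalColoring n r t k → n ≤ D * k ^ (2 * r + 1)
corollary1p8 t r 4≤t _ with t' , refl ← m≤n⇒∃[o]m+o≡n 4≤t =
  r * (10 + 4 * t') , 1 , λ n 1≤n k → local-colouring-bound r t' n k 1≤n
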